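{- Run algorithm $\mathrm{Square}$ (defined in the context) on requests $r_1,\dots,r_N$. Call request $r_i$ covered if $v_i-u_i\ge\rho(i)$. If $r_i$ and $r_j$ ($i\ne j$) are both covered, then the quarter-balls $Q(i)$ and $Q(j)$ are edge disjoint.
   Context: Time-line graph: nodes $0,1,\dots,n$ of a directed line; replicas $(v,t)$, $t\in\{0,1,2,\dots\}$; horizontal edges $((u,t),(u+1,t))$ and arcs $((v,t),(v,t+1))$. Requests $r_i=(v_i,t_i)$, $i=1,\dots,N$, with $0\le t_1\le\dots\le t_N$. $d_\infty((u,s),(v,t))=\max\{t-s,v-u\}$ if $s\le t,u\le v$, else $\infty$. Algorithm $\mathrm{Square}$: start with $F=\{(0,0)\}$, $t_0=0$. For $i=1,\dots,N$: (SQ1) add arcs from $(0,t_{i-1})$ to $(0,t_i)$; (SQ2) $\rho(i)=\min\{d_\infty(q,r_i): q\text{ a replica of }F\}$; (SQ3) among replicas of $F$ in $[v_i-5\rho(i),v_i]\times[t_i-5\rho(i),t_i]$ choose $q_i=(u_i,s_i)$ with $u_i$ minimal (ties arbitrary); (SQ4) add arcs from $(u_i,s_i)$ to $(u_i,t_i)$ and horizontal edges from $(u_i,t_i)$ to $(v_i,t_i)$; (SQ5) add arcs from $(u_i,t_i)$ to $(u_i,t_i+4\rho(i))$. Quarter-ball: for a replica $r=(v,t)$ and $\rho\ge 0$, $Q(r,\rho)$ is the subgraph of the time-line graph consisting of the replicas $(u,s)$ from which there is a directed path to $r$ of length at most $\rho$ (i.e. $u\le v$, $s\le t$, $(v-u)+(t-s)\le\rho$),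 together with the edges between them; $Q(i)=Q(r_i,\rho(i))$. -}

module Defs where

open import Data.Nat using (ℕ; zero; suc; _+_; _*_; _∸_; _≤_; _⊔_)
open import Data.Product using (_×_; _,_; Σ; ∃; ∃-syntax)
open import Data.Sum using (_⊎_)
open import Data.List using (List; []; map; upTo; _++_)
open import Data.List.Membership.Propositional using (_∈_)
open import Relation.Binary.PropositionalEquality using (_≡_)
open import Relation.Nullary using (¬_)

-- A replica (v , t): node v of the line, time t.
Replica : Set
Replica = ℕ × ℕ

data Edge : Set where
  hor : ℕ → ℕ → Edge
  arc : ℕ → ℕ → Edge

tail : Edge → Replica
tail (hor u t) = u , t
tail (arc v t) = v , t

head : Edge → Replica
head (hor u t) = suc u , t
head (arc v t) = v , suc t

-- The subgraph F maintained by the algorithm: the replica (0,0) together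
-- with a finite list of edges.  Replicas of F are (0,0) and the endpoints
-- of the edges of F.
Graph : Set
Graph = List Edge

InF : Graph → Replica → Set
InF F q = q ≡ (0 , 0) ⊎ (∃[ e ] (e ∈ F × (q ≡ tail e ⊎ q ≡ head e)))

range : ℕ → ℕ → List ℕ
range s t = map (s +_) (upTo (t ∸ s))

-- arcs from (u,s) to (u,t)  (empty if t ≤ s)
arcs : ℕ → ℕ → ℕ → Graph
arcs u s t = map (λ k → arc u k) (range s t)

hors : ℕ → ℕ → ℕ → Graph
hors t u v = map (λ k → hor k t) (range u v)

-- q = (u,s) precedes r = (v,t) in both coordinates (d_∞ finite)
_≼_ : Replica → Replica → Set
(u , s) ≼ (v , t) = u ≤ v × s ≤ t

-- d_∞(q,r) when q ≼ r
d∞ : Replica → Replica → ℕ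
d∞ (u , s) (v , t) = (t ∸ s) ⊔ (v ∸ u)

IsMinDist : Graph → Replica → ℕ → Set
IsMinDist F r ρ =
  (∃[ q ] (InF F q × q ≼ r × d∞ q r ≡ ρ)) ×
  (∀ q → InF F q → q ≼ r → ρ ≤ d∞ q r)

-- One iteration (SQ1)-(SQ5) of Square.  Input: current F, previous
-- request time tp, request r = (v,t).  Output: ρ(i), the chosen
-- q_i = (u,s), and the new F'.
record SquareStep (F : Graph) (tp : ℕ) (r : Replica)
                  (ρ u s : ℕ) (F' : Graph) : Set where
  field
    F₁ : Graph
    F₁-def : F₁ ≡ arcs 0 tp (Data.Product.proj₂ r) ++ F
    rho : IsMinDist F₁ r ρ
    q-in : InF F₁ (u , s)
    q-le : (u , s) ≼ r
    q-box-v : Data.Product.proj₁ r ≤ u + 5 * ρ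
    q-box-t : Data.Product.proj₂ r ≤ s + 5 * ρ
    q-min : ∀ u' s' → InF F₁ (u' , s') → (u' , s') ≼ r →
            Data.Product.proj₁ r ≤ u' + 5 * ρ →
            Data.Product.proj₂ r ≤ s' + 5 * ρ → u ≤ u'
    F'-def : F' ≡ hors (Data.Product.proj₂ r) u (Data.Product.proj₁ r)
                   ++ arcs u (Data.Product.proj₂ r) (Data.Product.proj₂ r + 4 * ρ)
                   ++ arcs u s (Data.Product.proj₂ r)
                   ++ F₁

-- time of the previous request, with t₀ = 0 (requests indexed 1..N)
prevTime : (ℕ → ℕ) → ℕ → ℕ
prevTime t zero = 0
prevTime t (suc zero) = 0
prevTime t (suc (suc j)) = t (suc j)

-- An execution of Square on requests r_i = (v i , t i), i = 1..N.
-- F i is the subgraph after processing r_i (F 0 = {(0,0)}).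
record SquareRun (N : ℕ) (v t : ℕ → ℕ) : Set where
  field
    F : ℕ → Graph
    ρ u s : ℕ → ℕ
    F-init : F 0 ≡ []
    step : ∀ i → 1 ≤ i → i ≤ N →
           SquareStep (F (i ∸ 1)) (prevTime t i) (v i , t i) (ρ i) (u i) (s i) (F i)

-- Quarter ball Q(r,ρ): replicas with a directed path to r of length ≤ ρ,
-- together with the edges between them.
InQVert : Replica → ℕ → Replica → Set
InQVert (v , t) ρ (u , s) = u ≤ v × s ≤ t × (v ∸ u) + (t ∸ s) ≤ ρ

InQEdge : Replica → ℕ → Edge → Set
InQEdge r ρ e = InQVert r ρ (tail e) × InQVert r ρ (head e)

EdgeDisjointQ : Replica → ℕ → Replica → ℕ → Set
EdgeDisjointQ r ρ r' ρ' = ¬ (∃[ e ] (InQEdge r ρ e × InQEdge r' ρ' e))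

-- If r_i (i < j) is covered, its horizontal segment [u_i, v_i] × {t_i} already
-- belongs to F when r_j is served.  An edge shared by Q(i) and Q(j) has its head
-- (a, b) with b ≤ t_i and v_i − a ≤ ρ(i) ≤ v_i − u_i, so the replica (a, t_i) of
-- that segment reaches r_j by a path strictly shorter than the one from the
-- edge's tail, whence d_∞((a, t_i), r_j) < ρ(j), contradicting the minimality of ρ(j).
module Submission where

open import Defs
open import Data.Nat using (ℕ; suc; _+_; _*_; _≤_; _<_; _∸_; _≤′_; ≤′-refl; ≤′-step; z≤n; s≤s)
open import Data.Nat.Properties
open import Data.Product using (_×_; _,_; proj₁; proj₂)
open import Data.Sum using (inj₁; inj₂)
open import Data.List.Membership.Propositional using (_∈_)
open import Data.List.Membership.Propositional.Properties using (∈-map⁺; ∈-upTo⁺; ∈-++⁺ˡ; ∈-++⁺ʳ)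
open import Data.List.Relation.Binary.Subset.Propositional using (_⊆_)
open import Data.List.Relation.Binary.Subset.Propositional.Properties using (⊆-refl; ⊆-trans)
open import Relation.Binary.PropositionalEquality using (_≢_; refl; sym; subst)
open import Relation.Binary.Definitions using (tri<; tri≈; tri>)
open import Relation.Nullary using (contradiction)

0<n∸m⇒m<n : ∀ {m n} → 0 < n ∸ m → m < n
0<n∸m⇒m<n {m} {n} p = ∸-cancelʳ-< (subst (_< n ∸ m) (sym (n∸n≡0 n)) p)

-- Length of a shortest directed path from q to r, when q ≼ r.
dist : Replica → Replica → ℕ
dist (u , s) (v , t) = (v ∸ u) + (t ∸ s)

d∞≤dist : ∀ q r → d∞ q r ≤ dist q r
d∞≤dist (u , s) (v , t) = ≤-trans (m⊔n≤m+n (t ∸ s) (v ∸ u)) (≤-reflexive (+-comm (t ∸ s) (v ∸ u)))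

dist-head<dist-tail : ∀ e r → head e ≼ r → dist (head e) r < dist (tail e) r
dist-head<dist-tail (hor a b) (v , t) (1+a≤v , _) = +-monoˡ-< (t ∸ b) (∸-monoʳ-< (n<1+n a) 1+a≤v)
dist-head<dist-tail (arc a b) (v , t) (_ , 1+b≤t) = +-monoʳ-< (v ∸ a) (∸-monoʳ-< (n<1+n b) 1+b≤t)

dist-monoˡ-time : ∀ a {s s'} r → s ≤ s' → dist (a , s') r ≤ dist (a , s) r
dist-monoˡ-time a (v , t) s≤s' = +-monoʳ-≤ (v ∸ a) (∸-monoʳ-≤ t s≤s')

InQVert⇒≼ : ∀ {r ρ q} → InQVert r ρ q → q ≼ r
InQVert⇒≼ (u≤v , s≤t , _) = u≤v , s≤t

InQVert⇒dist≤ : ∀ {r ρ q} → InQVert r ρ q → dist q r ≤ ρ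
InQVert⇒dist≤ (_ , _ , d≤ρ) = d≤ρ

InQEdge⇒dist-head< : ∀ {r ρ} e → InQEdge r ρ e → dist (head e) r < ρ
InQEdge⇒dist-head< {r} e (tail∈Q , head∈Q) =
  ≤-trans (dist-head<dist-tail e r (InQVert⇒≼ head∈Q)) (InQVert⇒dist≤ tail∈Q)

EdgeDisjointQ-sym : ∀ {r ρ r' ρ'} → EdgeDisjointQ r ρ r' ρ' → EdgeDisjointQ r' ρ' r ρ
EdgeDisjointQ-sym disjoint (e , e∈Q' , e∈Q) = disjoint (e , e∈Q , e∈Q')

InF-mono : ∀ {F G} → F ⊆ G → ∀ {q} → InF F q → InF G q
InF-mono F⊆G (inj₁ q≡00) = inj₁ q≡00
InF-mono F⊆G (inj₂ (e , e∈F , q∈e)) = inj₂ (e , F⊆G e∈F , q∈e)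

hor∈hors : ∀ {t u v c} → u ≤ c → c < v → hor c t ∈ hors t u v
hor∈hors {t} {u} {v} {c} u≤c c<v =
  subst (λ x → hor x t ∈ hors t u v) (m+[n∸m]≡n u≤c)
    (∈-map⁺ (λ k → hor k t) (∈-map⁺ (u +_) (∈-upTo⁺ (∸-monoˡ-< c<v u≤c))))

segment-replica : ∀ {t u v c} → u ≤ c → c ≤ v → u < v → InF (hors t u v) (c , t)
segment-replica {c = c} u≤c c≤v u<v with m≤n⇒m<n∨m≡n c≤v
... | inj₁ c<v = inj₂ (_ , hor∈hors u≤c c<v , inj₁ refl)
segment-replica {v = suc p} u≤c c≤v u<v | inj₂ refl =
  inj₂ (_ , hor∈hors (≤-pred u<v) ≤-refl , inj₂ refl)

module _ {F tp r ρ u s F'} (st : SquareStep F tp r ρ u s F') where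
  open SquareStep st

  F⊆F₁ : F ⊆ F₁
  F⊆F₁ e∈F rewrite F₁-def = ∈-++⁺ʳ _ e∈F

  F₁⊆F' : F₁ ⊆ F'
  F₁⊆F' e∈F₁ rewrite F'-def =
    ∈-++⁺ʳ (hors (proj₂ r) u (proj₁ r)) (∈-++⁺ʳ (arcs u (proj₂ r) (proj₂ r + 4 * ρ))
      (∈-++⁺ʳ (arcs u s (proj₂ r)) e∈F₁))

  hors⊆F' : hors (proj₂ r) u (proj₁ r) ⊆ F'
  hors⊆F' e∈hors rewrite F'-def = ∈-++⁺ˡ e∈hors

module _ {N v t} (R : SquareRun N v t) where
  open SquareRun R

  F-mono : ∀ {i j} → i ≤′ j → j ≤ N → F i ⊆ F j
  F-mono ≤′-refl _ = ⊆-refl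
  F-mono (≤′-step {j} i≤′j) 1+j≤N =
    ⊆-trans (F-mono i≤′j (<⇒≤ 1+j≤N)) (⊆-trans (F⊆F₁ st) (F₁⊆F' st))
    where st = step (suc j) (s≤s z≤n) 1+j≤N

  covered-earlier-edge-disjoint :
    (∀ i j → 1 ≤ i → i ≤ j → j ≤ N → t i ≤ t j) →
    ∀ {i j} → 1 ≤ i → i < j → j ≤ N → ρ i ≤ v i ∸ u i →
    EdgeDisjointQ (v i , t i) (ρ i) (v j , t j) (ρ j)
  covered-earlier-edge-disjoint t-mono {i} {suc j} 1≤i (s≤s i≤j) 1+j≤N covered (e , e∈Qi , e∈Qj) =
    <⇒≱ head-closer ρj≤d∞
    where
      sti = step i 1≤i (≤-trans i≤j (<⇒≤ 1+j≤N))
      stj = step (suc j) (s≤s z≤n) 1+j≤N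
      rj = v (suc j) , t (suc j)
      a = proj₁ (head e)
      head∈Qi = proj₂ e∈Qi
      ui≤vi : u i ≤ v i
      ui≤vi = proj₁ (SquareStep.q-le sti)
      ui≤a : u i ≤ a
      ui≤a = ∸-cancelʳ-≤ ui≤vi (≤-trans (≤-trans (m≤m+n _ _) (InQVert⇒dist≤ head∈Qi)) covered)
      ui<vi : u i < v i
      ui<vi = 0<n∸m⇒m<n (≤-trans (≤-trans (s≤s z≤n) (InQEdge⇒dist-head< e e∈Qi)) covered)
      q∈F₁ : InF (SquareStep.F₁ stj) (a , t i)
      q∈F₁ = InF-mono (⊆-trans (hors⊆F' sti) (⊆-trans (F-mono (≤⇒≤′ i≤j) (<⇒≤ 1+j≤N)) (F⊆F₁ stj)))
                      (segment-replica ui≤a (proj₁ head∈Qi) ui<vi)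
      q≼rj : (a , t i) ≼ rj
      q≼rj = proj₁ (proj₂ e∈Qj) , t-mono i (suc j) 1≤i (m≤n⇒m≤1+n i≤j) 1+j≤N
      ρj≤d∞ : ρ (suc j) ≤ d∞ (a , t i) rj
      ρj≤d∞ = proj₂ (SquareStep.rho stj) (a , t i) q∈F₁ q≼rj
      head-closer : d∞ (a , t i) rj < ρ (suc j)
      head-closer =
        ≤-<-trans (d∞≤dist (a , t i) rj)
          (≤-<-trans (dist-monoˡ-time a rj (proj₁ (proj₂ head∈Qi))) (InQEdge⇒dist-head< e e∈Qj))

lemma1 : (n N : ℕ) (v t : ℕ → ℕ) →
    (∀ i → 1 ≤ i → i ≤ N → v i ≤ n) →
    (∀ i j → 1 ≤ i → i ≤ j → j ≤ N → t i ≤ t j) →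
    (R : SquareRun N v t) →
    ∀ i j → 1 ≤ i → i ≤ N → 1 ≤ j → j ≤ N → i ≢ j →
    SquareRun.ρ R i ≤ v i ∸ SquareRun.u R i →
    SquareRun.ρ R j ≤ v j ∸ SquareRun.u R j →
    EdgeDisjointQ (v i , t i) (SquareRun.ρ R i) (v j , t j) (SquareRun.ρ R j)
lemma1 n N v t _ t-mono R i j 1≤i i≤N 1≤j j≤N i≢j covered-i covered-j with <-cmp i j
... | tri< i<j _ _ = covered-earlier-edge-disjoint R t-mono 1≤i i<j j≤N covered-i
... | tri≈ _ i≡j _ = contradiction i≡j i≢j
... | tri> _ _ j<i = EdgeDisjointQ-sym (covered-earlier-edge-disjoint R t-mono 1≤j j<i i≤N covered-j)
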